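{- Let $G$ be a connected graph with two vertices $v_1,v_2$ (no loops, possibly multiple edges), and let $|E(G)|$ be its number of edges. If $(r_1,r_2)$ is an arithmetical structure on $G$, then $r_1\mid |E(G)|$ and $r_2\mid |E(G)|$, so $r_1,r_2\le |E(G)|$. Moreover, the total number of arithmetical structures on $G$ is exactly $\sigma_0(|E(G)|^2)$.
   Context: $\sigma_0(m)$ is the number of positive divisors of $m$. For a graph on two vertices with $e=|E(G)|$ edges between them, an arithmetical structure is a pair $(r_1,r_2)$ of positive integers with $\gcd(r_1,r_2)=1$ such that $r_1\mid e r_2$ and $r_2\mid e r_1$ (i.e. there are positive integers $d_1,d_2$ with $r_1d_1=er_2$, $r_2d_2=er_1$). Structures are ordered pairs: $(r_1,r_2)$ and $(r_2,r_1)$ are counted separately when different. -}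

module Defs where

open import Data.Nat using (ℕ; suc; _*_; _≤_; _<_)
open import Data.Nat.Divisibility using (_∣_; _∣?_)
open import Data.Nat.GCD using (gcd)
open import Data.List using (List; length; filter; upTo; map)
open import Data.Product using (_×_)
open import Relation.Binary.PropositionalEquality using (_≡_)

σ₀ : ℕ → ℕ
σ₀ m = length (filter (λ d → d ∣? m) (map suc (upTo m)))

-- arithmetical structure (r₁ , r₂) on the two-vertex graph with e edges
IsArithStructure : ℕ → ℕ → ℕ → Set
IsArithStructure e r₁ r₂ =
  (0 < r₁) × (0 < r₂) × (gcd r₁ r₂ ≡ 1) × (r₁ ∣ e * r₂) × (r₂ ∣ e * r₁)

module Submission where

-- Writing the fraction d / e in lowest terms, d ↦ (d / gcd d e , e / gcd d e), is a
-- bijection from the divisors of e² onto the arithmetical structures, with inverse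
-- (r₁ , r₂) ↦ (e / r₂) · r₁. That r₁ divides e (and so is at most e) is Euclid's lemma
-- applied to r₁ ∣ e · r₂ with r₁, r₂ coprime.

open import Defs
open import Data.Nat using (ℕ; zero; suc; _*_; _/_; _≤_; _<_; NonZero; >-nonZero; ≢-nonZero⁻¹)
open import Data.Nat.Properties using (*-comm; *-assoc; *-identityʳ; *-cancelˡ-≡; m*n≢0; n≢0⇒n>0; suc-injective)
open import Data.Nat.Divisibility
open import Data.Nat.DivMod using (m/n*n≡m; m*n/n≡m; m≥n⇒m/n>0; /-congˡ; /-congʳ)
open import Data.Nat.GCD
open import Data.Nat.Coprimality using (coprime-divisor; gcd≡1⇒coprime; coprime⇒gcd≡1; coprime-/gcd)
open import Data.List using (List; length; map; filter; upTo)
open import Data.List.Properties using (length-map)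
open import Data.List.Membership.Propositional using (_∈_)
open import Data.List.Membership.Propositional.Properties using (∈-map⁺; ∈-map⁻; ∈-filter⁺; ∈-filter⁻; ∈-upTo⁺)
open import Data.List.Relation.Unary.Unique.Propositional using (Unique)
import Data.List.Relation.Unary.Unique.Propositional.Properties as Unique
open import Data.Product using (_×_; _,_; Σ; proj₁; proj₂; uncurry)
open import Data.Sum using (inj₂)
open import Function.Bundles using (_⇔_; mk⇔)
open import Relation.Nullary using (contradiction)
open import Relation.Binary.PropositionalEquality using (_≡_; refl; sym; trans; cong; cong₂; subst; module ≡-Reasoning)

∣-*-coprime : ∀ {m n k} → gcd m n ≡ 1 → m ∣ k * n → m ∣ k
∣-*-coprime {m} {n} {k} gcd≡1 m∣kn =
  coprime-divisor (gcd≡1⇒coprime gcd≡1) (subst (m ∣_) (*-comm k n) m∣kn)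

arithStructure-∣ : ∀ {e r₁ r₂} → IsArithStructure e r₁ r₂ → r₁ ∣ e × r₂ ∣ e
arithStructure-∣ {r₁ = r₁} {r₂} (_ , _ , gcd≡1 , r₁∣er₂ , r₂∣er₁) =
  ∣-*-coprime gcd≡1 r₁∣er₂ , ∣-*-coprime (trans (gcd-comm r₂ r₁) gcd≡1) r₂∣er₁

-- σ₀ m is definitionally length (divisors m).
divisors : ℕ → List ℕ
divisors m = filter (_∣? m) (map suc (upTo m))

divisors-unique : ∀ m → Unique (divisors m)
divisors-unique m = Unique.filter⁺ (_∣? m) (Unique.map⁺ suc-injective (Unique.upTo⁺ m))

∈-divisors⁻ : ∀ {m d} → d ∈ divisors m → NonZero d × d ∣ m
∈-divisors⁻ {m} d∈ with ∈-filter⁻ (_∣? m) {xs = map suc (upTo m)} d∈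
... | d∈sucs , d∣m with ∈-map⁻ suc d∈sucs
...   | _ , _ , refl = _ , d∣m

∈-divisors⁺ : ∀ {m d} .{{_ : NonZero m}} → d ∣ m → d ∈ divisors m
∈-divisors⁺ {m} {zero}  0∣m = contradiction (0∣⇒≡0 0∣m) (≢-nonZero⁻¹ m)
∈-divisors⁺ {m} {suc d} d∣m = ∈-filter⁺ (_∣? m) (∈-map⁺ suc (∈-upTo⁺ (∣⇒≤ d∣m))) d∣m

gcd-nonZeroʳ : ∀ m n .{{_ : NonZero n}} → NonZero (gcd m n)
gcd-nonZeroʳ m n = >-nonZero (n≢0⇒n>0 (gcd[m,n]≢0 m n (inj₂ (≢-nonZero⁻¹ n))))

/-nonZero : ∀ {m n} .{{_ : NonZero m}} .{{_ : NonZero n}} → n ∣ m → NonZero (m / n)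
/-nonZero n∣m = >-nonZero (m≥n⇒m/n>0 (∣⇒≤ n∣m))

/-cancelˡ-≡ : ∀ {m n o} .{{_ : NonZero m}} .{{_ : NonZero n}} .{{_ : NonZero o}} →
              n ∣ m → o ∣ m → m / n ≡ m / o → n ≡ o
/-cancelˡ-≡ {m} {n} {o} n∣m o∣m eq = *-cancelˡ-≡ n o (m / n) {{/-nonZero n∣m}} (begin
  m / n * n ≡⟨ m/n*n≡m n∣m ⟩
  m         ≡⟨ m/n*n≡m o∣m ⟨
  m / o * o ≡⟨ cong (_* o) eq ⟨
  m / n * o ∎)
  where open ≡-Reasoning

lowestTerms : (m n : ℕ) .{{_ : NonZero n}} → ℕ × ℕ
lowestTerms m n = m / gcd m n , n / gcd m n
  where instance _ = gcd-nonZeroʳ m n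

lowestTerms-injectiveˡ : ∀ {m m′ n} .{{_ : NonZero n}} →
                         lowestTerms m n ≡ lowestTerms m′ n → m ≡ m′
lowestTerms-injectiveˡ {m} {m′} {n} eq = begin
  m                  ≡⟨ m/n*n≡m (gcd[m,n]∣m m n) ⟨
  m / g * g          ≡⟨ cong₂ _*_ (cong proj₁ eq) g≡g′ ⟩
  m′ / g′ * g′       ≡⟨ m/n*n≡m (gcd[m,n]∣m m′ n) ⟩
  m′                 ∎
  where
  open ≡-Reasoning
  g g′ : ℕ
  g  = gcd m n
  g′ = gcd m′ n
  instance
    g≢0 : NonZero g
    g≢0 = gcd-nonZeroʳ m n
    g′≢0 : NonZero g′
    g′≢0 = gcd-nonZeroʳ m′ n
  g≡g′ : g ≡ g′
  g≡g′ = /-cancelˡ-≡ (gcd[m,n]∣n m n) (gcd[m,n]∣n m′ n) (cong proj₂ eq)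

lowestTerms-isArithStructure : ∀ {d n} .{{_ : NonZero d}} .{{_ : NonZero n}} →
                               d ∣ n * n → uncurry (IsArithStructure n) (lowestTerms d n)
lowestTerms-isArithStructure {d} {n} d∣n*n =
  n≢0⇒n>0 (m/gcd[m,n]≢0 d n) ,
  n≢0⇒n>0 (n/gcd[m,n]≢0 d n) ,
  coprime⇒gcd≡1 (coprime-/gcd d n) ,
  m∣n*o⇒m/n∣o g∣d (subst (d ∣_) n*n≡n*[n/g]*g d∣n*n) ,
  ∣-trans (m/n∣m g∣n) (m∣m*n (d / g))
  where
  open ≡-Reasoning
  g : ℕ
  g = gcd d n
  instance
    g≢0 : NonZero g
    g≢0 = gcd-nonZeroʳ d n
  g∣d : g ∣ d
  g∣d = gcd[m,n]∣m d n
  g∣n : g ∣ n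
  g∣n = gcd[m,n]∣n d n
  n*n≡n*[n/g]*g : n * n ≡ n * (n / g) * g
  n*n≡n*[n/g]*g = begin
    n * n           ≡⟨ cong (n *_) (m/n*n≡m g∣n) ⟨
    n * (n / g * g) ≡⟨ *-assoc n (n / g) g ⟨
    n * (n / g) * g ∎

lowestTerms-∣ : ∀ {n a b} .{{_ : NonZero n}} .{{_ : NonZero b}} →
                b ∣ n → gcd a b ≡ 1 → lowestTerms (n / b * a) n ≡ (a , b)
lowestTerms-∣ {n} {a} {b} b∣n gcd≡1 = cong₂ _,_ numerator denominator
  where
  open ≡-Reasoning
  k : ℕ
  k = n / b
  instance
    k≢0 : NonZero k
    k≢0 = /-nonZero b∣n
    g≢0 : NonZero (gcd (k * a) n)
    g≢0 = gcd-nonZeroʳ (k * a) n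
  k*b≡n : k * b ≡ n
  k*b≡n = m/n*n≡m b∣n
  gcd≡k : gcd (k * a) n ≡ k
  gcd≡k = begin
    gcd (k * a) n       ≡⟨ cong (gcd (k * a)) k*b≡n ⟨
    gcd (k * a) (k * b) ≡⟨ c*gcd[m,n]≡gcd[cm,cn] k a b ⟨
    k * gcd a b         ≡⟨ cong (k *_) gcd≡1 ⟩
    k * 1               ≡⟨ *-identityʳ k ⟩
    k                   ∎
  numerator : k * a / gcd (k * a) n ≡ a
  numerator = begin
    k * a / gcd (k * a) n ≡⟨ /-congʳ gcd≡k ⟩
    k * a / k             ≡⟨ /-congˡ {o = k} (*-comm k a) ⟩
    a * k / k             ≡⟨ m*n/n≡m a k ⟩
    a                     ∎
  denominator : n / gcd (k * a) n ≡ b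
  denominator = begin
    n / gcd (k * a) n ≡⟨ /-congʳ gcd≡k ⟩
    n / k             ≡⟨ /-congˡ {o = k} k*b≡n ⟨
    k * b / k         ≡⟨ /-congˡ {o = k} (*-comm k b) ⟩
    b * k / k         ≡⟨ m*n/n≡m b k ⟩
    b                 ∎

arithStructures : (e : ℕ) .{{_ : NonZero e}} → List (ℕ × ℕ)
arithStructures e = map (λ d → lowestTerms d e) (divisors (e * e))

arithStructures-unique : ∀ e .{{_ : NonZero e}} → Unique (arithStructures e)
arithStructures-unique e = Unique.map⁺ lowestTerms-injectiveˡ (divisors-unique (e * e))

∈-arithStructures⁻ : ∀ {e r₁ r₂} .{{_ : NonZero e}} →
                     (r₁ , r₂) ∈ arithStructures e → IsArithStructure e r₁ r₂
∈-arithStructures⁻ {e} p =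
  let d , d∈ , eq = ∈-map⁻ (λ d → lowestTerms d e) p
      d≢0 , d∣e*e = ∈-divisors⁻ d∈
  in subst (uncurry (IsArithStructure e)) (sym eq) (lowestTerms-isArithStructure {{d≢0}} d∣e*e)

∈-arithStructures⁺ : ∀ {e r₁ r₂} .{{_ : NonZero e}} →
                     IsArithStructure e r₁ r₂ → (r₁ , r₂) ∈ arithStructures e
∈-arithStructures⁺ {e} {r₁} {r₂} A@(_ , r₂>0 , gcd≡1 , _ , _) =
  subst (_∈ arithStructures e) (lowestTerms-∣ r₂∣e gcd≡1)
    (∈-map⁺ (λ d → lowestTerms d e) (∈-divisors⁺ {{m*n≢0 e e}} d∣e*e))
  where
  instance
    r₂≢0 : NonZero r₂
    r₂≢0 = >-nonZero r₂>0
  r₁∣e : r₁ ∣ e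
  r₁∣e = proj₁ (arithStructure-∣ A)
  r₂∣e : r₂ ∣ e
  r₂∣e = proj₂ (arithStructure-∣ A)
  d∣e*e : e / r₂ * r₁ ∣ e * e
  d∣e*e = *-pres-∣ (m/n∣m r₂∣e) r₁∣e

lemma3p2 : (e : ℕ) → 0 < e →
    ((r₁ r₂ : ℕ) → IsArithStructure e r₁ r₂ →
      (r₁ ∣ e) × (r₂ ∣ e) × (r₁ ≤ e) × (r₂ ≤ e))
    × (Σ (List (ℕ × ℕ)) λ L →
        Unique L
        × ((r₁ r₂ : ℕ) → ((r₁ , r₂) ∈ L) ⇔ IsArithStructure e r₁ r₂)
        × (length L ≡ σ₀ (e * e)))
lemma3p2 e e>0 =
  bounds ,
  arithStructures e ,
  arithStructures-unique e ,
  (λ r₁ r₂ → mk⇔ ∈-arithStructures⁻ ∈-arithStructures⁺) ,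
  length-map (λ d → lowestTerms d e) (divisors (e * e))
  where
  instance
    e≢0 : NonZero e
    e≢0 = >-nonZero e>0
  bounds : (r₁ r₂ : ℕ) → IsArithStructure e r₁ r₂ → (r₁ ∣ e) × (r₂ ∣ e) × (r₁ ≤ e) × (r₂ ≤ e)
  bounds r₁ r₂ A with arithStructure-∣ A
  ... | r₁∣e , r₂∣e = r₁∣e , r₂∣e , ∣⇒≤ r₁∣e , ∣⇒≤ r₂∣e
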